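{- Let $n\geq 5$ and let $(d_1,\dots,d_n)$ be a sequence of non-negative integers satisfying - $d_2\geq d_3\geq\cdots\geq d_n\geq 4$, - $D:=\sum_{i=1}^n (-1)^{i-1} d_i$ is equal to $4$ if $n$ is odd, and is one of $0,2,4$ if $n$ is even. Then there exists a triangular multigraph $G$ on vertices $v_1,\dots,v_n$ with $\deg(v_i)=d_i$ for all $i$.
   Context: Note that $d_1$ is not assumed to be the largest term. A multigraph is a finite graph in which multiple edges between the same pair of vertices are allowed; the degree of a vertex is the number of incident edges counted with multiplicity. A triangle in a multigraph consists of three distinct vertices which are pairwise adjacent. A multigraph is triangular if every edge is contained in a triangle. -}

module Defs where

open import Data.Nat using (ℕ; zero; suc; _<_; _≤_)
open import Data.Nat.DivMod using (_%_)
open import Data.Fin using (Fin; toℕ)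
open import Data.Vec.Base using (tabulate; foldr)
import Data.Vec.Base as V
open import Data.Integer as ℤ using (ℤ; +_; -_)
open import Data.Product using (Σ; _×_; ∃-syntax)
open import Data.Sum using (_⊎_)
open import Relation.Binary.PropositionalEquality using (_≡_; _≢_)

record Multigraph (n : ℕ) : Set where
  field
    mult      : Fin n → Fin n → ℕ
    symmetric : ∀ i j → mult i j ≡ mult j i
    loopless  : ∀ i → mult i i ≡ 0
open Multigraph public

Adjacent : ∀ {n} → Multigraph n → Fin n → Fin n → Set
Adjacent G i j = 0 < mult G i j

deg : ∀ {n} → Multigraph n → Fin n → ℕ
deg G i = V.sum (tabulate (λ j → mult G i j))

Triangular : ∀ {n} → Multigraph n → Set
Triangular {n} G = ∀ i j → Adjacent G i j →
  ∃[ k ] (k ≢ i × k ≢ j × Adjacent G i k × Adjacent G j k)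

-- alternating sum  Σ_{i=1}^n (-1)^{i-1} d_i  (index 0 of Fin n is d_1)
altSum : ∀ {n} → (Fin n → ℕ) → ℤ
altSum {zero}  d = + 0
altSum {suc n} d = + d Fin.zero ℤ.- altSum (λ i → d (Fin.suc i))
  where import Data.Fin as Fin

{-# OPTIONS --safe #-}
module Submission where

-- Write n = m + 5 and number the vertices 0, …, m + 4, so that d is indexed from 0.  The square of
-- the cycle 0, 1, …, m + 4 is a 4-regular multigraph in which every edge lies in a triangle.  Trading
-- its edge {1, m+4} for {0, 1} and {0, m+4} (t = 1), and additionally {1, 3} for {0, 1} and {0, 3}
-- (t = 2), raises the degree of vertex 0 by 2t and no other; in all three graphs every edge lies in a
-- triangle of the common part `band`.  Adding x_k parallel copies of each rung {k, k+1} keeps this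
-- property and adds x_{a-1} + x_a to the degree of vertex a.  With e_k = d_{k+1} - 4, the equations
-- d_{k+1} = 4 + x_k + x_{k+1} are solved by the alternating tail sums x_k = e_k - e_{k+1} + ⋯, which
-- are nonnegative because e is nonincreasing; they give x_0 = Σ (-1)^k e_k, so the remaining equation
-- d_0 = 4 + 2t + x_0 says exactly that the alternating sum of d exceeds that of (4, …, 4) by 2t, and
-- the hypothesis on D provides t ∈ {0, 1, 2}.

open import Defs
open import Data.Nat using (ℕ; zero; suc; _+_; _*_; _∸_; _≤_; _<_; _%_; z≤n; s≤s; s≤s⁻¹; z<s; s<s)
open import Data.Nat.Properties
open import Data.Fin as Fin using (Fin; toℕ; fromℕ<)
open import Data.Fin.Patterns using (0F; 1F; 2F)
open import Data.Fin.Properties using (toℕ<n; toℕ-fromℕ<)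
open import Data.Integer using (ℤ; +_)
import Data.Integer as ℤ
import Data.Integer.Properties as ℤᵖ
import Data.Integer.Tactic.RingSolver as ℤ-Solver
open import Data.Product using (Σ; _×_; _,_; proj₁; proj₂; ∃-syntax)
open import Data.Sum using (_⊎_; inj₁; inj₂)
open import Relation.Nullary using (yes; no)
open import Relation.Nullary.Negation using (contradiction)
open import Function using (_∘_; case_of_)
open import Relation.Binary.PropositionalEquality
import Data.Vec.Base as V
open import Data.Nat.Tactic.RingSolver using (solve-∀)
open import Algebra.Properties.CommutativeMonoid.Sum +-0-commutativeMonoid
  using (sum; sum-syntax; ∑-distrib-+; ∑-comm; sum-cong-≗; sum-replicate-zero)

-- Edge multiplicities on ℕ × ℕ; the graphs built below vanish outside N × N, and toMultigraph
-- restricts them to Fin N.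
Graph : Set
Graph = ℕ → ℕ → ℕ

δ : ℕ → ℕ → ℕ → ℕ
δ zero    zero    w = w
δ zero    (suc b) w = 0
δ (suc a) zero    w = 0
δ (suc a) (suc b) w = δ a b w

δ-refl : ∀ a {w} → δ a a w ≡ w
δ-refl zero    = refl
δ-refl (suc a) = δ-refl a

δ-≢ : ∀ {a b} w → a ≢ b → δ a b w ≡ 0
δ-≢ {zero}  {zero}  w a≢b = contradiction refl a≢b
δ-≢ {zero}  {suc b} w a≢b = refl
δ-≢ {suc a} {zero}  w a≢b = refl
δ-≢ {suc a} {suc b} w a≢b = δ-≢ w (a≢b ∘ cong suc)

δ-sym : ∀ a b {w} → δ a b w ≡ δ b a w
δ-sym zero    zero    = refl
δ-sym zero    (suc b) = refl
δ-sym (suc a) zero    = refl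
δ-sym (suc a) (suc b) = δ-sym a b

δ-zero : ∀ a b → δ a b 0 ≡ 0
δ-zero zero    zero    = refl
δ-zero zero    (suc b) = refl
δ-zero (suc a) zero    = refl
δ-zero (suc a) (suc b) = δ-zero a b

δ-comm : ∀ a b c e {w} → δ a b (δ c e w) ≡ δ c e (δ a b w)
δ-comm zero    zero    c e = refl
δ-comm zero    (suc b) c e = sym (δ-zero c e)
δ-comm (suc a) zero    c e = sym (δ-zero c e)
δ-comm (suc a) (suc b) c e = δ-comm a b c e

δ-pos : ∀ a b {w} → 0 < δ a b w → a ≡ b × 0 < w
δ-pos zero    zero    p = refl , p
δ-pos (suc a) (suc b) p with δ-pos a b p
... | a≡b , 0<w = cong suc a≡b , 0<w

∑-zero : ∀ r → ∑[ k < r ] 0 ≡ 0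
∑-zero = sum-replicate-zero

∑-δ : ∀ {a r} (f : ℕ → ℕ) → a < r → ∑[ k < r ] δ a (toℕ k) (f (toℕ k)) ≡ f a
∑-δ {zero}  {suc r} f _ = trans (cong (_+_ (f 0)) (∑-zero r)) (+-identityʳ (f 0))
∑-δ {suc a} {suc r} f (s≤s a<r) = ∑-δ (f ∘ suc) a<r

∑-δ-≥ : ∀ {a r} (f : ℕ → ℕ) → r ≤ a → ∑[ k < r ] δ a (toℕ k) (f (toℕ k)) ≡ 0
∑-δ-≥ {a}     {zero}  f _ = refl
∑-δ-≥ {suc a} {suc r} f (s≤s r≤a) = ∑-δ-≥ (f ∘ suc) r≤a

edge : ℕ → ℕ → ℕ → Graph
edge u v w a b = δ a u (δ b v w) + δ a v (δ b u w)

infixr 5 _⊕_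
_⊕_ : Graph → Graph → Graph
(g ⊕ h) a b = g a b + h a b

⨁ : ℕ → (ℕ → Graph) → Graph
⨁ r g a b = ∑[ k < r ] g (toℕ k) a b

Symmetric : Graph → Set
Symmetric g = ∀ a b → g a b ≡ g b a

Loopless : Graph → Set
Loopless g = ∀ a → g a a ≡ 0

edge-symmetric : ∀ u v w → Symmetric (edge u v w)
edge-symmetric u v w a b = trans (+-comm (δ a u _) _)
  (cong₂ _+_ (δ-comm a v b u) (δ-comm a u b v))

edge-loopless : ∀ {u v} w → u ≢ v → Loopless (edge u v w)
edge-loopless {u} {v} w u≢v a =
  cong₂ _+_ (δ-δ-≢ u≢v) (δ-δ-≢ (u≢v ∘ sym))
  where
  δ-δ-≢ : ∀ {u v} → u ≢ v → ∀ {w} → δ a u (δ a v w) ≡ 0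
  δ-δ-≢ {u} {v} u≢v {w} with a ≟ u
  ... | yes refl = trans (cong (δ a a) (δ-≢ w u≢v)) (δ-zero a a)
  ... | no  a≢u  = δ-≢ _ a≢u

⊕-symmetric : ∀ {g h} → Symmetric g → Symmetric h → Symmetric (g ⊕ h)
⊕-symmetric sg sh a b = cong₂ _+_ (sg a b) (sh a b)

⊕-loopless : ∀ {g h} → Loopless g → Loopless h → Loopless (g ⊕ h)
⊕-loopless lg lh a = cong₂ _+_ (lg a) (lh a)

⨁-symmetric : ∀ r {g} → (∀ k → Symmetric (g k)) → Symmetric (⨁ r g)
⨁-symmetric r sg a b = sum-cong-≗ {r} (λ k → sg (toℕ k) a b)

⨁-loopless : ∀ r {g} → (∀ k → Loopless (g k)) → Loopless (⨁ r g)
⨁-loopless r lg a = trans (sum-cong-≗ {r} (λ k → lg (toℕ k) a)) (∑-zero r)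

record Proper (g : Graph) : Set where
  constructor proper
  field
    isSymmetric : Symmetric g
    isLoopless  : Loopless g
open Proper

edge-proper : ∀ {u v} w → u ≢ v → Proper (edge u v w)
edge-proper {u} {v} w u≢v = proper (edge-symmetric u v w) (edge-loopless w u≢v)

⊕-proper : ∀ {g h} → Proper g → Proper h → Proper (g ⊕ h)
⊕-proper {g} {h} pg ph = proper
  (⊕-symmetric {g} {h} (isSymmetric pg) (isSymmetric ph))
  (⊕-loopless {g} {h} (isLoopless pg) (isLoopless ph))

⨁-proper : ∀ r {g} → (∀ k → Proper (g k)) → Proper (⨁ r g)
⨁-proper r {g} pg = proper (⨁-symmetric r {g} (isSymmetric ∘ pg)) (⨁-loopless r {g} (isLoopless ∘ pg))

degree : ℕ → Graph → ℕ → ℕ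
degree N g a = ∑[ j < N ] g a (toℕ j)

record Degree (N : ℕ) (g : Graph) (f : ℕ → ℕ) : Set where
  constructor degree≗
  field degree-at : ∀ a → degree N g a ≡ f a
open Degree

Degree-≗ : ∀ {N g f f′} → Degree N g f → (∀ a → f a ≡ f′ a) → Degree N g f′
Degree-≗ dg f≗f′ = degree≗ λ a → trans (degree-at dg a) (f≗f′ a)

degree-⊕ : ∀ N g h a → degree N (g ⊕ h) a ≡ degree N g a + degree N h a
degree-⊕ N g h a = ∑-distrib-+ {N} (λ j → g a (toℕ j)) (λ j → h a (toℕ j))

⊕-Degree : ∀ {N g h f f′} → Degree N g f → Degree N h f′ → Degree N (g ⊕ h) (λ a → f a + f′ a)
⊕-Degree {N} {g} {h} dg dh = degree≗ λ a →
  trans (degree-⊕ N g h a) (cong₂ _+_ (degree-at dg a) (degree-at dh a))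

∑-δ-δ : ∀ {N v} a u w → v < N → ∑[ j < N ] δ a u (δ (toℕ j) v w) ≡ δ a u w
∑-δ-δ {N} {v} a u w v<N = trans
  (sum-cong-≗ {N} (λ j → trans (δ-comm a u (toℕ j) v) (δ-sym (toℕ j) v)))
  (∑-δ (λ _ → δ a u w) v<N)

edge-Degree : ∀ {N u v} w → u < N → v < N → Degree N (edge u v w) (λ a → δ a u w + δ a v w)
edge-Degree {N} {u} {v} w u<N v<N = degree≗ λ a → trans
  (∑-distrib-+ {N} (λ j → δ a u (δ (toℕ j) v w)) (λ j → δ a v (δ (toℕ j) u w)))
  (cong₂ _+_ (∑-δ-δ a u w v<N) (∑-δ-δ a v w u<N))

⨁-edge-Degree : ∀ {N r} (u v w : ℕ → ℕ) → (∀ k → k < r → u k < N × v k < N) →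
  Degree N (⨁ r (λ k → edge (u k) (v k) (w k)))
    (λ a → ∑[ k < r ] δ a (u (toℕ k)) (w (toℕ k)) + ∑[ k < r ] δ a (v (toℕ k)) (w (toℕ k)))
⨁-edge-Degree {N} {r} u v w ends = degree≗ λ a → begin
  ∑[ j < N ] ∑[ k < r ] edge (u (toℕ k)) (v (toℕ k)) (w (toℕ k)) a (toℕ j)
    ≡⟨ ∑-comm {N} {r} (λ j k → edge (u (toℕ k)) (v (toℕ k)) (w (toℕ k)) a (toℕ j)) ⟩
  ∑[ k < r ] degree N (edge (u (toℕ k)) (v (toℕ k)) (w (toℕ k))) a
    ≡⟨ sum-cong-≗ {r} (λ k → let (u<N , v<N) = ends (toℕ k) (toℕ<n k)
                              in degree-at (edge-Degree _ u<N v<N) a) ⟩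
  ∑[ k < r ] (δ a (u (toℕ k)) (w (toℕ k)) + δ a (v (toℕ k)) (w (toℕ k)))
    ≡⟨ ∑-distrib-+ {r} (λ k → δ a (u (toℕ k)) (w (toℕ k))) (λ k → δ a (v (toℕ k)) (w (toℕ k))) ⟩
  ∑[ k < r ] δ a (u (toℕ k)) (w (toℕ k)) + ∑[ k < r ] δ a (v (toℕ k)) (w (toℕ k)) ∎
  where open ≡-Reasoning

m+n>0⇒m>0∨n>0 : ∀ m {n} → 0 < m + n → 0 < m ⊎ 0 < n
m+n>0⇒m>0∨n>0 zero    0<n = inj₂ 0<n
m+n>0⇒m>0∨n>0 (suc m) _   = inj₁ z<s

⊕-pos : ∀ {g h} a b → 0 < (g ⊕ h) a b → 0 < g a b ⊎ 0 < h a b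
⊕-pos {g} a b = m+n>0⇒m>0∨n>0 (g a b)

m>0⇒m+n>0 : ∀ {m n} → 0 < m → 0 < m + n
m>0⇒m+n>0 p = <-≤-trans p (m≤m+n _ _)

n>0⇒m+n>0 : ∀ {m n} → 0 < n → 0 < m + n
n>0⇒m+n>0 p = <-≤-trans p (m≤n+m _ _)

⨁-pos : ∀ r {g} a b → 0 < ⨁ r g a b → ∃[ k ] k < r × 0 < g k a b
⨁-pos (suc r) {g} a b p with m+n>0⇒m>0∨n>0 (g 0 a b) p
... | inj₁ q = 0 , z<s , q
... | inj₂ q with ⨁-pos r {g ∘ suc} a b q
...   | k , k<r , q′ = suc k , s<s k<r , q′

⨁-adj : ∀ r g k a b → k < r → 0 < g k a b → 0 < ⨁ r g a b
⨁-adj (suc r) g zero    a b _         p = m>0⇒m+n>0 p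
⨁-adj (suc r) g (suc k) a b (s≤s k<r) p = n>0⇒m+n>0 (⨁-adj r (g ∘ suc) k a b k<r p)

⊕-adjˡ : ∀ g h a b → 0 < g a b → 0 < (g ⊕ h) a b
⊕-adjˡ g h a b = m>0⇒m+n>0

⊕-adjʳ : ∀ g h a b → 0 < h a b → 0 < (g ⊕ h) a b
⊕-adjʳ g h a b = n>0⇒m+n>0

edge-pos : ∀ {u v w} a b → 0 < edge u v w a b → (a ≡ u × b ≡ v) ⊎ (a ≡ v × b ≡ u)
edge-pos {u} {v} {w} a b p with m+n>0⇒m>0∨n>0 (δ a u (δ b v w)) p
... | inj₁ q = let (a≡u , q′) = δ-pos a u q in inj₁ (a≡u , proj₁ (δ-pos b v q′))
... | inj₂ q = let (a≡v , q′) = δ-pos a v q in inj₂ (a≡v , proj₁ (δ-pos b u q′))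

edge-adj : ∀ u v {w} → 0 < w → 0 < edge u v w u v
edge-adj u v {w} p = m>0⇒m+n>0 (subst (0 <_) (sym (trans (δ-refl u) (δ-refl v))) p)

Triangle : ℕ → Graph → ℕ → ℕ → Set
Triangle N g a b = ∃[ c ] c < N × c ≢ a × c ≢ b × 0 < g a c × 0 < g b c

Triangularᴳ : ℕ → Graph → Set
Triangularᴳ N g = ∀ a b → 0 < g a b → Triangle N g a b

Triangle-sym : ∀ {N g a b} → Triangle N g a b → Triangle N g b a
Triangle-sym (c , c<N , c≢a , c≢b , ac , bc) = c , c<N , c≢b , c≢a , bc , ac

Triangle-mono : ∀ {N g h a b} → (∀ {a b} → 0 < g a b → 0 < h a b) →
  Triangle N g a b → Triangle N h a b
Triangle-mono g⊆h (c , c<N , c≢a , c≢b , ac , bc) = c , c<N , c≢a , c≢b , g⊆h ac , g⊆h bc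

record InTrianglesOf (N : ℕ) (h g : Graph) : Set where
  constructor inTriangles
  field triangle-of : ∀ a b → 0 < g a b → Triangle N h a b
open InTrianglesOf

edge-inTriangles : ∀ {N h u v} w → Triangle N h u v → InTrianglesOf N h (edge u v w)
edge-inTriangles {u = u} {v} w t = inTriangles λ a b p → case edge-pos {u} {v} {w} a b p of λ where
  (inj₁ (refl , refl)) → t
  (inj₂ (refl , refl)) → Triangle-sym t

⊕-inTriangles : ∀ {N h g g′} → InTrianglesOf N h g → InTrianglesOf N h g′ →
  InTrianglesOf N h (g ⊕ g′)
⊕-inTriangles {g = g} {g′} tg tg′ = inTriangles λ a b p → case ⊕-pos {g} {g′} a b p of λ where
  (inj₁ q) → triangle-of tg a b q
  (inj₂ q) → triangle-of tg′ a b q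

⨁-inTriangles : ∀ {N h} r {g} → (∀ k → k < r → InTrianglesOf N h (g k)) →
  InTrianglesOf N h (⨁ r g)
⨁-inTriangles r {g} tg = inTriangles λ a b p →
  let (k , k<r , q) = ⨁-pos r {g} a b p in triangle-of (tg k k<r) a b q

inTriangles-triangular : ∀ {N h g} → InTrianglesOf N h g → (∀ a b → 0 < h a b → 0 < g a b) →
  Triangularᴳ N g
inTriangles-triangular tg h⊆g a b p = Triangle-mono (h⊆g _ _) (triangle-of tg a b p)

toMultigraph : ∀ N (g : Graph) → Proper g → Multigraph N
toMultigraph N g pg = record
  { mult      = λ i j → g (toℕ i) (toℕ j)
  ; symmetric = λ i j → isSymmetric pg (toℕ i) (toℕ j)
  ; loopless  = λ i → isLoopless pg (toℕ i)
  }

sum-tabulate : ∀ {n} (f : Fin n → ℕ) → V.sum (V.tabulate f) ≡ sum f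
sum-tabulate {zero}  f = refl
sum-tabulate {suc n} f = cong (_+_ (f Fin.zero)) (sum-tabulate (f ∘ Fin.suc))

toMultigraph-deg : ∀ N g pg i → deg (toMultigraph N g pg) i ≡ degree N g (toℕ i)
toMultigraph-deg N g pg i = sum-tabulate {N} (λ j → g (toℕ i) (toℕ j))

toMultigraph-triangular : ∀ N g pg → Triangularᴳ N g → Triangular (toMultigraph N g pg)
toMultigraph-triangular N g pg tg i j p with tg (toℕ i) (toℕ j) p
... | c , c<N , c≢i , c≢j , ic , jc =
  fromℕ< c<N , c≢i ∘ toℕ-≡ , c≢j ∘ toℕ-≡ , subst (λ x → 0 < g (toℕ i) x) (sym c≡) ic
             , subst (λ x → 0 < g (toℕ j) x) (sym c≡) jc
  where
  c≡ = toℕ-fromℕ< c<N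
  toℕ-≡ : ∀ {k} → fromℕ< c<N ≡ k → c ≡ toℕ k
  toℕ-≡ refl = sym c≡

path : ℕ → (ℕ → ℕ) → Graph
path r p = ⨁ r (λ k → edge k (suc k) (p k))

path-proper : ∀ r p → Proper (path r p)
path-proper r p = ⨁-proper r (λ k → edge-proper (p k) (<⇒≢ (n<1+n k)))

path-degree : ∀ {N r} p a → r < N →
  degree N (path r p) a
    ≡ ∑[ k < r ] δ a (toℕ k) (p (toℕ k)) + ∑[ k < r ] δ a (suc (toℕ k)) (p (toℕ k))
path-degree p a r<N =
  degree-at (⨁-edge-Degree (λ k → k) suc p (λ k k<r → <-trans k<r r<N , <-≤-trans (s<s k<r) r<N)) a

path-degree-zero : ∀ {N r} p → 0 < r → r < N → degree N (path r p) 0 ≡ p 0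
path-degree-zero {N} {r} p 0<r r<N = begin
  degree N (path r p) 0                               ≡⟨ path-degree p 0 r<N ⟩
  ∑[ k < r ] δ 0 (toℕ k) (p (toℕ k)) + ∑[ k < r ] 0  ≡⟨ cong₂ _+_ (∑-δ p 0<r) (∑-zero r) ⟩
  p 0 + 0                                             ≡⟨ +-identityʳ (p 0) ⟩
  p 0                                                 ∎
  where open ≡-Reasoning

path-degree-suc : ∀ {N r} p a → suc a < r → r < N → degree N (path r p) (suc a) ≡ p a + p (suc a)
path-degree-suc p a a<r r<N = trans (path-degree p (suc a) r<N)
  (trans (cong₂ _+_ (∑-δ p a<r) (∑-δ p (<-trans (n<1+n a) a<r))) (+-comm (p (suc a)) (p a)))

path-degree-last : ∀ {N r} p → suc r < N → degree N (path (suc r) p) (suc r) ≡ p r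
path-degree-last {r = r} p r<N =
  trans (path-degree p (suc r) r<N) (cong₂ _+_ (∑-δ-≥ {suc r} p ≤-refl) (∑-δ p (n<1+n r)))

window : ℕ → ℕ → ℕ → ℕ
window zero    zero    a       = 0
window zero    (suc r) zero    = 1
window zero    (suc r) (suc a) = window zero r a
window (suc j) r       zero    = 0
window (suc j) r       (suc a) = window j r a

window-< : ∀ {a r} → a < r → window 0 r a ≡ 1
window-< {zero}  {suc r} _         = refl
window-< {suc a} {suc r} (s≤s a<r) = window-< a<r

window-≥ : ∀ {a r} → r ≤ a → window 0 r a ≡ 0
window-≥ {a}     {zero}  _         = refl
window-≥ {suc a} {suc r} (s≤s r≤a) = window-≥ r≤a

∑-δ-window : ∀ a j r → ∑[ k < r ] δ a (j + toℕ k) 1 ≡ window j r a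
∑-δ-window zero    zero    zero    = refl
∑-δ-window zero    zero    (suc r) = cong (_+_ 1) (∑-zero r)
∑-δ-window (suc a) zero    zero    = refl
∑-δ-window (suc a) zero    (suc r) = ∑-δ-window a zero r
∑-δ-window zero    (suc j) r       = ∑-zero r
∑-δ-window (suc a) (suc j) r       = ∑-δ-window a j r

window-δ-last : ∀ {c r} → c ≤ r → window 0 r c + δ c r 1 ≡ 1
window-δ-last {c} c≤r with m≤n⇒m<n∨m≡n c≤r
... | inj₁ c<r  = cong₂ _+_ (window-< c<r) (δ-≢ 1 (<⇒≢ c<r))
... | inj₂ refl = cong₂ _+_ (window-≥ {c} ≤-refl) (δ-refl c)

window-δ-first : ∀ {c r} → c < r → window 1 r c + δ c 0 1 ≡ 1
window-δ-first {zero}  _   = refl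
window-δ-first {suc c} c<r = cong (λ w → w + 0) (window-< (<-trans (n<1+n c) c<r))

translates : ℕ → ℕ → ℕ → Graph
translates i j r = ⨁ r (λ k → edge (i + k) (j + k) 1)

translates-proper : ∀ i j r → (∀ k → i + k ≢ j + k) → Proper (translates i j r)
translates-proper i j r i≢j = ⨁-proper r (λ k → edge-proper 1 (i≢j k))

translates-Degree : ∀ {N} i j r → i + r ≤ N → j + r ≤ N →
  Degree N (translates i j r) (λ a → window i r a + window j r a)
translates-Degree i j r i+r≤N j+r≤N = degree≗ λ a → trans
  (degree-at (⨁-edge-Degree (_+_ i) (_+_ j) (λ _ → 1) λ k k<r → below i k<r i+r≤N , below j k<r j+r≤N) a)
  (cong₂ _+_ (∑-δ-window a i r) (∑-δ-window a j r))
  where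
  below : ∀ i {k r N} → k < r → i + r ≤ N → i + k < N
  below i k<r i+r≤N = <-≤-trans (+-monoʳ-< i k<r) i+r≤N

module Strip (m : ℕ) where

  N : ℕ
  N = 5 + m

  rungs : Graph
  rungs = translates 0 1 (4 + m)

  chords : Graph
  chords = translates 2 4 (suc m)

  spokes : Graph
  spokes = edge 0 2 1 ⊕ edge 0 (3 + m) 1 ⊕ edge 0 (4 + m) 1

  band : Graph
  band = rungs ⊕ chords ⊕ spokes

  clasp : Fin 3 → Graph
  clasp 0F = edge 1 3 1 ⊕ edge 1 (4 + m) 1
  clasp 1F = edge 1 3 1 ⊕ edge 0 (4 + m) 1 ⊕ edge 0 1 1
  clasp 2F = edge 0 3 1 ⊕ edge 0 (4 + m) 1 ⊕ edge 0 1 2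

  base : Fin 3 → Graph
  base t = band ⊕ clasp t

  0<N : 0 < N
  0<N = z<s
  1<N : 1 < N
  1<N = s<s z<s
  2<N : 2 < N
  2<N = s<s (s<s z<s)
  3<N : 3 < N
  3<N = s<s (s<s (s<s z<s))
  3+m<N : 3 + m < N
  3+m<N = s≤s (n≤1+n (3 + m))
  4+m<N : 4 + m < N
  4+m<N = ≤-refl

  bandDegree : ℕ → ℕ
  bandDegree a = (window 0 (4 + m) a + window 1 (4 + m) a) + ((window 2 (suc m) a + window 4 (suc m) a)
    + ((δ a 0 1 + δ a 2 1) + ((δ a 0 1 + δ a (3 + m) 1) + (δ a 0 1 + δ a (4 + m) 1))))

  claspDegree : Fin 3 → ℕ → ℕ
  claspDegree t a = (δ a 1 2 + (δ a 3 1 + δ a (4 + m) 1)) + δ a 0 (2 * toℕ t)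

  band-Degree : Degree N band bandDegree
  band-Degree =
    ⊕-Degree (translates-Degree 0 1 (4 + m) (n≤1+n _) ≤-refl)
    (⊕-Degree (translates-Degree 2 4 (suc m) (m≤n+m (3 + m) 2) ≤-refl)
    (⊕-Degree (edge-Degree 1 0<N 2<N)
    (⊕-Degree (edge-Degree 1 0<N 3+m<N) (edge-Degree 1 0<N 4+m<N))))

  clasp-Degree : ∀ t → Degree N (clasp t) (claspDegree t)
  clasp-Degree 0F = Degree-≗
    (⊕-Degree (edge-Degree 1 1<N 3<N) (edge-Degree 1 1<N 4+m<N))
    λ { 0 → refl ; 1 → refl ; 2 → refl ; 3 → refl ; (suc (suc (suc (suc c)))) → sym (+-identityʳ _) }
  clasp-Degree 1F = Degree-≗
    (⊕-Degree (edge-Degree 1 1<N 3<N) (⊕-Degree (edge-Degree 1 0<N 4+m<N) (edge-Degree 1 0<N 1<N)))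
    λ { 0 → refl ; 1 → refl ; 2 → refl ; 3 → refl ; (suc (suc (suc (suc c)))) → refl }
  clasp-Degree 2F = Degree-≗
    (⊕-Degree (edge-Degree 1 0<N 3<N) (⊕-Degree (edge-Degree 1 0<N 4+m<N) (edge-Degree 2 0<N 1<N)))
    λ { 0 → refl ; 1 → refl ; 2 → refl ; 3 → refl ; (suc (suc (suc (suc c)))) → refl }

  base-Degree : ∀ t → Degree N (base t) (λ a → bandDegree a + claspDegree t a)
  base-Degree t = ⊕-Degree band-Degree (clasp-Degree t)

  base-degree-zero : ∀ t → degree N (base t) 0 ≡ 4 + 2 * toℕ t
  base-degree-zero t = degree-at (base-Degree t) 0

  -- Vertex 3 + c lies on two rungs; it has a forward chord unless c = m, when the spoke {0, 3 + m}
  -- replaces it, and a backward chord unless c = 0, when the clasp edge at 3 replaces it.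
  base-degree-middle : ∀ t c → c ≤ m → degree N (base t) (3 + c) ≡ 4
  base-degree-middle t c c≤m = trans (degree-at (base-Degree t) (3 + c)) value
    where
    regroup : ∀ w v d e → w + v + (d + 0) + (e + 0 + 0) ≡ (w + d) + (v + e)
    regroup = solve-∀
    value : bandDegree (3 + c) + claspDegree t (3 + c) ≡ 4
    value rewrite window-< {c} {suc m} (s≤s c≤m) | window-< {c} {2 + m} (s≤s (m≤n⇒m≤1+n c≤m))
      | δ-≢ {c} {suc m} 1 (<⇒≢ (s≤s c≤m)) =
      cong (_+_ 2) (trans (regroup (window 0 m c) _ _ _)
                          (cong₂ _+_ (window-δ-last c≤m) (window-δ-first (s≤s c≤m))))

  base-degree-last : ∀ t → degree N (base t) (4 + m) ≡ 4
  base-degree-last t = trans (degree-at (base-Degree t) (4 + m)) value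
    where
    value : bandDegree (4 + m) + claspDegree t (4 + m) ≡ 4
    value rewrite window-≥ {m} {m} ≤-refl | window-< {m} {suc m} ≤-refl | window-≥ {suc m} {m} (n≤1+n m)
      | δ-≢ {suc m} {m} 1 (<⇒≢ ≤-refl ∘ sym) | δ-refl m {1} = refl

  base-degree-suc : ∀ t a → a < 4 + m → degree N (base t) (suc a) ≡ 4
  base-degree-suc t 0             _ = degree-at (base-Degree t) 1
  base-degree-suc t 1             _ = degree-at (base-Degree t) 2
  base-degree-suc t (suc (suc c)) (s≤s (s≤s c<2+m)) with m≤n⇒m<n∨m≡n (s≤s⁻¹ c<2+m)
  ... | inj₁ c<1+m = base-degree-middle t c (s≤s⁻¹ c<1+m)
  ... | inj₂ refl  = base-degree-last t

  band-proper : Proper band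
  band-proper =
    ⊕-proper (translates-proper 0 1 (4 + m) (λ k ()))
    (⊕-proper (translates-proper 2 4 (suc m) (λ k ()))
    (⊕-proper (edge-proper 1 (λ ())) (⊕-proper (edge-proper 1 (λ ())) (edge-proper 1 (λ ())))))

  band-flip : ∀ a b → 0 < band a b → 0 < band b a
  band-flip a b = subst (0 <_) (isSymmetric band-proper a b)

  band-rung : ∀ k → k < 4 + m → 0 < band k (suc k)
  band-rung k k<4+m = ⊕-adjˡ rungs (chords ⊕ spokes) k (suc k)
    (⨁-adj (4 + m) (λ k → edge k (suc k) 1) k k (suc k) k<4+m (edge-adj k (suc k) z<s))

  band-rung′ : ∀ k → k < 4 + m → 0 < band (suc k) k
  band-rung′ k k<4+m = band-flip k (suc k) (band-rung k k<4+m)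

  band-chord : ∀ j → j < suc m → 0 < band (2 + j) (4 + j)
  band-chord j j<1+m = ⊕-adjʳ rungs (chords ⊕ spokes) (2 + j) (4 + j) (⊕-adjˡ chords spokes (2 + j) (4 + j)
    (⨁-adj (suc m) (λ k → edge (2 + k) (4 + k) 1) j (2 + j) (4 + j) j<1+m (edge-adj (2 + j) (4 + j) z<s)))

  band-spoke : ∀ v → 0 < spokes 0 v → 0 < band 0 v
  band-spoke v p = ⊕-adjʳ rungs (chords ⊕ spokes) 0 v (⊕-adjʳ chords spokes 0 v p)

  band-0-2 : 0 < band 0 2
  band-0-2 = band-spoke 2 (⊕-adjˡ (edge 0 2 1) (edge 0 (3 + m) 1 ⊕ edge 0 (4 + m) 1) 0 2 (edge-adj 0 2 z<s))

  band-0-3+m : 0 < band 0 (3 + m)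
  band-0-3+m = band-spoke (3 + m) (⊕-adjʳ (edge 0 2 1) (edge 0 (3 + m) 1 ⊕ edge 0 (4 + m) 1) 0 (3 + m)
    (⊕-adjˡ (edge 0 (3 + m) 1) (edge 0 (4 + m) 1) 0 (3 + m) (edge-adj 0 (3 + m) z<s)))

  band-0-4+m : 0 < band 0 (4 + m)
  band-0-4+m = band-spoke (4 + m) (⊕-adjʳ (edge 0 2 1) (edge 0 (3 + m) 1 ⊕ edge 0 (4 + m) 1) 0 (4 + m)
    (⊕-adjʳ (edge 0 (3 + m) 1) (edge 0 (4 + m) 1) 0 (4 + m) (edge-adj 0 (4 + m) z<s)))

  rung-triangle : ∀ k → k < 4 + m → Triangle N band k (suc k)
  rung-triangle 0 _ = 2 , 2<N , (λ ()) , (λ ()) , band-0-2 , band-rung 1 (s≤s (s≤s z≤n))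
  rung-triangle 1 _ = 0 , 0<N , (λ ()) , (λ ()) , band-rung′ 0 z<s , band-flip 0 2 band-0-2
  rung-triangle (suc (suc j)) (s≤s (s≤s j<2+m)) with m≤n⇒m<n∨m≡n (s≤s⁻¹ j<2+m)
  ... | inj₁ j<1+m = 4 + j , s≤s (s≤s (s≤s (s≤s j<1+m))) , (λ ()) , (λ ())
                   , band-chord j j<1+m , band-rung (3 + j) (s≤s (s≤s (s≤s j<1+m)))
  ... | inj₂ refl  = 0 , 0<N , (λ ()) , (λ ())
                   , band-flip 0 (3 + m) band-0-3+m , band-flip 0 (4 + m) band-0-4+m

  chord-triangle : ∀ j → j < suc m → Triangle N band (2 + j) (4 + j)
  chord-triangle j j<1+m = 3 + j , s≤s (s≤s (s≤s (m≤n⇒m≤1+n j<1+m))) , (λ ()) , (λ ())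
                         , band-rung (2 + j) (s≤s (s≤s (m≤n⇒m≤1+n j<1+m)))
                         , band-rung′ (3 + j) (s≤s (s≤s (s≤s j<1+m)))

  triangle-0-2 : Triangle N band 0 2
  triangle-0-2 = 1 , 1<N , (λ ()) , (λ ()) , band-rung 0 z<s , band-rung′ 1 (s≤s (s≤s z≤n))

  triangle-0-3 : Triangle N band 0 3
  triangle-0-3 = 2 , 2<N , (λ ()) , (λ ()) , band-0-2 , band-rung′ 2 (s≤s (s≤s (s≤s z≤n)))

  triangle-1-3 : Triangle N band 1 3
  triangle-1-3 = 2 , 2<N , (λ ()) , (λ ())
               , band-rung 1 (s≤s (s≤s z≤n)) , band-rung′ 2 (s≤s (s≤s (s≤s z≤n)))

  triangle-0-3+m : Triangle N band 0 (3 + m)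
  triangle-0-3+m = 4 + m , 4+m<N , (λ ()) , (λ ()) , band-0-4+m , band-rung (3 + m) ≤-refl

  triangle-0-4+m : Triangle N band 0 (4 + m)
  triangle-0-4+m = 3 + m , 3+m<N , (λ ()) , (λ ()) , band-0-3+m , band-rung′ (3 + m) ≤-refl

  triangle-1-4+m : Triangle N band 1 (4 + m)
  triangle-1-4+m = 0 , 0<N , (λ ()) , (λ ()) , band-rung′ 0 z<s , band-flip 0 (4 + m) band-0-4+m

  path-inTriangles : ∀ p → InTrianglesOf N band (path (4 + m) p)
  path-inTriangles p = ⨁-inTriangles (4 + m) λ k k<4+m → edge-inTriangles (p k) (rung-triangle k k<4+m)

  band-inTriangles : InTrianglesOf N band band
  band-inTriangles =
    ⊕-inTriangles (path-inTriangles (λ _ → 1))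
    (⊕-inTriangles (⨁-inTriangles (suc m) λ j j<1+m → edge-inTriangles 1 (chord-triangle j j<1+m))
    (⊕-inTriangles (edge-inTriangles 1 triangle-0-2)
    (⊕-inTriangles (edge-inTriangles 1 triangle-0-3+m) (edge-inTriangles 1 triangle-0-4+m))))

  clasp-inTriangles : ∀ t → InTrianglesOf N band (clasp t)
  clasp-inTriangles 0F = ⊕-inTriangles (edge-inTriangles 1 triangle-1-3) (edge-inTriangles 1 triangle-1-4+m)
  clasp-inTriangles 1F = ⊕-inTriangles (edge-inTriangles 1 triangle-1-3)
    (⊕-inTriangles (edge-inTriangles 1 triangle-0-4+m) (edge-inTriangles 1 (rung-triangle 0 z<s)))
  clasp-inTriangles 2F = ⊕-inTriangles (edge-inTriangles 1 triangle-0-3)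
    (⊕-inTriangles (edge-inTriangles 1 triangle-0-4+m) (edge-inTriangles 2 (rung-triangle 0 z<s)))

  clasp-proper : ∀ t → Proper (clasp t)
  clasp-proper 0F = ⊕-proper (edge-proper 1 (λ ())) (edge-proper 1 (λ ()))
  clasp-proper 1F = ⊕-proper (edge-proper 1 (λ ())) (⊕-proper (edge-proper 1 (λ ())) (edge-proper 1 (λ ())))
  clasp-proper 2F = ⊕-proper (edge-proper 1 (λ ())) (⊕-proper (edge-proper 1 (λ ())) (edge-proper 2 (λ ())))

  strip : Fin 3 → (ℕ → ℕ) → Graph
  strip t x = base t ⊕ path (4 + m) x

  strip-proper : ∀ t x → Proper (strip t x)
  strip-proper t x = ⊕-proper (⊕-proper band-proper (clasp-proper t)) (path-proper (4 + m) x)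

  strip-triangular : ∀ t x → Triangularᴳ N (strip t x)
  strip-triangular t x = inTriangles-triangular
    (⊕-inTriangles (⊕-inTriangles band-inTriangles (clasp-inTriangles t)) (path-inTriangles x))
    (λ a b p → ⊕-adjˡ (base t) (path (4 + m) x) a b (⊕-adjˡ band (clasp t) a b p))

  strip-degree-zero : ∀ t x → degree N (strip t x) 0 ≡ 4 + 2 * toℕ t + x 0
  strip-degree-zero t x = trans (degree-⊕ N (base t) (path (4 + m) x) 0)
    (cong₂ _+_ (base-degree-zero t) (path-degree-zero x z<s 4+m<N))

  strip-degree-suc : ∀ t x a → x (4 + m) ≡ 0 → a < 4 + m →
    degree N (strip t x) (suc a) ≡ 4 + (x a + x (suc a))
  strip-degree-suc t x a x-end a<4+m = trans (degree-⊕ N (base t) (path (4 + m) x) (suc a))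
    (cong₂ _+_ (base-degree-suc t a a<4+m) (path-part (m≤n⇒m<n∨m≡n a<4+m)))
    where
    path-part : suc a < 4 + m ⊎ suc a ≡ 4 + m → degree N (path (4 + m) x) (suc a) ≡ x a + x (suc a)
    path-part (inj₁ 1+a<4+m) = path-degree-suc x a 1+a<4+m 4+m<N
    path-part (inj₂ refl)    = trans (path-degree-last x 4+m<N)
                                     (sym (trans (cong (_+_ (x a)) x-end) (+-identityʳ (x a))))

  record Parameters (d : Fin N → ℕ) : Set where
    field
      t           : Fin 3
      x           : ℕ → ℕ
      x-end       : x (4 + m) ≡ 0
      degree-zero : d Fin.zero ≡ 4 + 2 * toℕ t + x 0
      degree-suc  : ∀ j → d (Fin.suc j) ≡ 4 + (x (toℕ j) + x (suc (toℕ j)))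

  realise : ∀ {d} → Parameters d → ∃[ G ] (Triangular {N} G × (∀ i → deg G i ≡ d i))
  realise {d} ps =
    G , toMultigraph-triangular N (strip t x) (strip-proper t x) (strip-triangular t x) , degrees
    where
    open Parameters ps
    G : Multigraph N
    G = toMultigraph N (strip t x) (strip-proper t x)
    degrees : ∀ i → deg G i ≡ d i
    degrees Fin.zero    = trans (toMultigraph-deg N (strip t x) (strip-proper t x) Fin.zero)
      (trans (strip-degree-zero t x) (sym degree-zero))
    degrees (Fin.suc j) = trans (toMultigraph-deg N (strip t x) (strip-proper t x) (Fin.suc j))
      (trans (strip-degree-suc t x (toℕ j) x-end (toℕ<n j)) (sym (degree-suc j)))

altSum-cong : ∀ {r} {f g : Fin r → ℕ} → (∀ i → f i ≡ g i) → altSum f ≡ altSum g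
altSum-cong {zero}  f≗g = refl
altSum-cong {suc r} f≗g = cong₂ (λ a s → + a ℤ.- s) (f≗g Fin.zero) (altSum-cong (f≗g ∘ Fin.suc))

altSum-+ : ∀ {r} (f g : Fin r → ℕ) → altSum (λ i → f i + g i) ≡ altSum f ℤ.+ altSum g
altSum-+ {zero}  f g = refl
altSum-+ {suc r} f g = begin
  + (f₀ + g₀) ℤ.- altSum (λ i → f (Fin.suc i) + g (Fin.suc i))
    ≡⟨ cong₂ ℤ._-_ (ℤᵖ.pos-+ f₀ g₀) (altSum-+ (f ∘ Fin.suc) (g ∘ Fin.suc)) ⟩
  (+ f₀ ℤ.+ + g₀) ℤ.- (altSum (f ∘ Fin.suc) ℤ.+ altSum (g ∘ Fin.suc))
    ≡⟨ interchange (+ f₀) (+ g₀) (altSum (f ∘ Fin.suc)) (altSum (g ∘ Fin.suc)) ⟩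
  (+ f₀ ℤ.- altSum (f ∘ Fin.suc)) ℤ.+ (+ g₀ ℤ.- altSum (g ∘ Fin.suc)) ∎
  where
  open ≡-Reasoning
  f₀ = f Fin.zero
  g₀ = g Fin.zero
  interchange : ∀ a b c e → (a ℤ.+ b) ℤ.- (c ℤ.+ e) ≡ (a ℤ.- c) ℤ.+ (b ℤ.- e)
  interchange = ℤ-Solver.solve-∀

altSum-const : ∀ r c → altSum {r} (λ _ → c) ≡ + (c * (r % 2))
altSum-const 0             c = cong +_ (sym (*-zeroʳ c))
altSum-const 1             c = cong +_ (trans (+-identityʳ c) (sym (*-identityʳ c)))
altSum-const (suc (suc r)) c = trans (cancel (+ c) (altSum {r} (λ _ → c))) (altSum-const r c)
  where
  cancel : ∀ a s → a ℤ.- (a ℤ.- s) ≡ s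
  cancel = ℤ-Solver.solve-∀

Nonincreasing : ∀ {r} → (Fin r → ℕ) → Set
Nonincreasing e = ∀ i j → toℕ i ≤ toℕ j → e j ≤ e i

Nonincreasing-tail : ∀ {r} {e : Fin (suc r) → ℕ} → Nonincreasing e → Nonincreasing (e ∘ Fin.suc)
Nonincreasing-tail ni i j i≤j = ni (Fin.suc i) (Fin.suc j) (s≤s i≤j)

-- altTail e k = e k ∸ (e (k + 1) ∸ (e (k + 2) ∸ ⋯)); the truncated subtractions are exact when e
-- is nonincreasing.
altTail : ∀ {r} → (Fin r → ℕ) → ℕ → ℕ
altTail {zero}  e k       = 0
altTail {suc r} e zero    = e Fin.zero ∸ altTail (e ∘ Fin.suc) zero
altTail {suc r} e (suc k) = altTail (e ∘ Fin.suc) k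

altTail-end : ∀ {r} (e : Fin r → ℕ) → altTail e r ≡ 0
altTail-end {zero}  e = refl
altTail-end {suc r} e = altTail-end (e ∘ Fin.suc)

altTail-tail-≤ : ∀ {r} (e : Fin (suc r) → ℕ) → Nonincreasing e → altTail (e ∘ Fin.suc) 0 ≤ e Fin.zero
altTail-tail-≤ {zero}  e ni = z≤n
altTail-tail-≤ {suc r} e ni = ≤-trans (m∸n≤m (e (Fin.suc Fin.zero)) (altTail (e ∘ Fin.suc ∘ Fin.suc) 0))
                                      (ni Fin.zero (Fin.suc Fin.zero) z≤n)

altTail-split : ∀ {r} (e : Fin r → ℕ) → Nonincreasing e →
  ∀ j → e j ≡ altTail e (toℕ j) + altTail e (suc (toℕ j))
altTail-split e ni Fin.zero    = sym (m∸n+n≡m (altTail-tail-≤ e ni))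
altTail-split e ni (Fin.suc j) = altTail-split (e ∘ Fin.suc) (Nonincreasing-tail ni) j

altSum-altTail : ∀ {r} (e : Fin r → ℕ) → Nonincreasing e → altSum e ≡ + altTail e 0
altSum-altTail {zero}  e ni = refl
altSum-altTail {suc r} e ni = begin
  + e Fin.zero ℤ.- altSum (e ∘ Fin.suc)
    ≡⟨ cong (ℤ._-_ (+ e Fin.zero)) (altSum-altTail (e ∘ Fin.suc) (Nonincreasing-tail ni)) ⟩
  + e Fin.zero ℤ.- + altTail (e ∘ Fin.suc) 0
    ≡⟨ ℤᵖ.m-n≡m⊖n (e Fin.zero) (altTail (e ∘ Fin.suc) 0) ⟩
  e Fin.zero ℤ.⊖ altTail (e ∘ Fin.suc) 0
    ≡⟨ ℤᵖ.⊖-≥ (altTail-tail-≤ e ni) ⟩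
  + altTail e 0 ∎
  where open ≡-Reasoning

parity-excess : ∀ n (D : ℤ) →
  (n % 2 ≡ 1 × D ≡ + 4) ⊎ (n % 2 ≡ 0 × (D ≡ + 0 ⊎ D ≡ + 2 ⊎ D ≡ + 4)) →
  Σ (Fin 3) λ t → D ≡ altSum {n} (λ _ → 4) ℤ.+ + (2 * toℕ t)
parity-excess n D parity rewrite altSum-const n 4 = excess parity
  where
  excess : (n % 2 ≡ 1 × D ≡ + 4) ⊎ (n % 2 ≡ 0 × (D ≡ + 0 ⊎ D ≡ + 2 ⊎ D ≡ + 4)) →
    Σ (Fin 3) λ t → D ≡ + (4 * (n % 2)) ℤ.+ + (2 * toℕ t)
  excess (inj₁ (odd , refl))              rewrite odd  = 0F , refl
  excess (inj₂ (even , inj₁ refl))        rewrite even = 0F , refl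
  excess (inj₂ (even , inj₂ (inj₁ refl))) rewrite even = 1F , refl
  excess (inj₂ (even , inj₂ (inj₂ refl))) rewrite even = 2F , refl

stripParameters : ∀ m (d : Fin (5 + m) → ℕ) →
  Nonincreasing (d ∘ Fin.suc) → (∀ j → 4 ≤ d (Fin.suc j)) →
  ∀ t → altSum d ≡ altSum {5 + m} (λ _ → 4) ℤ.+ + (2 * toℕ t) → Strip.Parameters m d
stripParameters m d ni ge4 t excess = record
  { t           = t
  ; x           = altTail e
  ; x-end       = altTail-end e
  ; degree-zero = ℤᵖ.+-injective first
  ; degree-suc  = λ j → trans (sym (m∸n+n≡m (ge4 j)))
                              (trans (+-comm (e j) 4) (cong (_+_ 4) (altTail-split e e-ni j)))
  }
  where
  e : Fin (4 + m) → ℕ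
  e j = d (Fin.suc j) ∸ 4
  e-ni : Nonincreasing e
  e-ni i j i≤j = ∸-monoˡ-≤ 4 (ni i j i≤j)
  C : ℤ
  C = altSum {4 + m} (λ _ → 4)
  tail-sum : altSum (d ∘ Fin.suc) ≡ + altTail e 0 ℤ.+ C
  tail-sum = begin
    altSum (d ∘ Fin.suc)             ≡⟨ altSum-cong (λ j → sym (m∸n+n≡m (ge4 j))) ⟩
    altSum (λ j → e j + 4)           ≡⟨ altSum-+ e (λ _ → 4) ⟩
    altSum e ℤ.+ C                   ≡⟨ cong (ℤ._+ C) (altSum-altTail e e-ni) ⟩
    + altTail e 0 ℤ.+ C              ∎
    where open ≡-Reasoning
  first : + d Fin.zero ≡ + (4 + 2 * toℕ t + altTail e 0)
  first = begin
    + d Fin.zero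
      ≡⟨ split (+ d Fin.zero) (altSum (d ∘ Fin.suc)) ⟩
    altSum d ℤ.+ altSum (d ∘ Fin.suc)
      ≡⟨ cong₂ ℤ._+_ excess tail-sum ⟩
    ((+ 4 ℤ.- C) ℤ.+ + (2 * toℕ t)) ℤ.+ (+ altTail e 0 ℤ.+ C)
      ≡⟨ cancel (+ 4) C (+ (2 * toℕ t)) (+ altTail e 0) ⟩
    + (4 + 2 * toℕ t + altTail e 0) ∎
    where
    open ≡-Reasoning
    split : ∀ a s → a ≡ (a ℤ.- s) ℤ.+ s
    split = ℤ-Solver.solve-∀
    cancel : ∀ f c u y → ((f ℤ.- c) ℤ.+ u) ℤ.+ (y ℤ.+ c) ≡ (f ℤ.+ u) ℤ.+ y
    cancel = ℤ-Solver.solve-∀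

lemma2p2 : (n : ℕ) → 5 ≤ n → (d : Fin n → ℕ)
  → (∀ (i j : Fin n) → 1 ≤ toℕ i → toℕ i ≤ toℕ j → d j ≤ d i)
  → (∀ (i : Fin n) → 1 ≤ toℕ i → 4 ≤ d i)
  → ((n % 2 ≡ 1 × altSum d ≡ + 4)
     ⊎ (n % 2 ≡ 0 × (altSum d ≡ + 0 ⊎ altSum d ≡ + 2 ⊎ altSum d ≡ + 4)))
  → ∃[ G ] (Triangular {n} G × (∀ (i : Fin n) → deg G i ≡ d i))
lemma2p2 (suc (suc (suc (suc (suc m))))) (s≤s (s≤s (s≤s (s≤s (s≤s z≤n))))) d mono ge4 parity =
  let (t , excess) = parity-excess (5 + m) (altSum d) parity
  in Strip.realise m (stripParameters m d tail-nonincreasing tail-≥4 t excess)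
  where
  tail-nonincreasing : Nonincreasing (d ∘ Fin.suc)
  tail-nonincreasing i j i≤j = mono (Fin.suc i) (Fin.suc j) (s≤s z≤n) (s≤s i≤j)
  tail-≥4 : ∀ j → 4 ≤ d (Fin.suc j)
  tail-≥4 j = ge4 (Fin.suc j) (s≤s z≤n)
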